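{- Let $T=(\{Y_1,Y_2,Y_3,XZ_1,XZ_2,XZ_3\},\{Z_1,Z_2,Z_3,XY_1,XY_2,XY_3\})$, where $X,Y_1,Y_2,Y_3$ are mutually disjoint, $X,Z_1,Z_2,Z_3$ are mutually disjoint, $Y_1Y_2Y_3=Z_1Z_2Z_3$, $Y_i\ne Z_j$ for all $i,j\in\{1,2,3\}$, and $X\ne\emptyset$. Then every extension of $T$ is a shift of a trade of the same form (with sets $X',Y'_i,Z'_i$ satisfying the same conditions).
   Context: Let $V$ be a finite set; juxtaposition $XY$ of subsets denotes symmetric difference $X\oplus Y$, and $x_i=\{i\}$. A $[t]$-trade is a pair $T=(T_+,T_-)$ of disjoint finite multisets of subsets of $V$ (blocks) such that for each $i\le t$ every $i$-subset of $V$ lies in equally many blocks of $T_+$ as of $T_-$ (with multiplicity); its volume is $|T_+|=|T_-|$. (The $T$ above is a $[2]$-trade of volume $6$.) For $Y\subseteq V$, the $Y$-shift of $T$ replaces every block $B$ by $Y\oplus B$. For an element $s$, the $s$-projection of a trade removes $s$ from every block containing it, and then cancels blocks appearing in both legs (one occurrence from each leg at a time). A trade $T'$ is an extension of a $[t]$-trade $T$ if $T'$ is a $[t]$-trade, $T$ is the $s$-projection of $T'$ for some $s$ not in any block of $T$, and $T'$ has the same volume as $T$. -}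

module Defs where

open import Data.Nat using (ℕ; _≤_)
open import Data.Bool using (Bool; true; false; _xor_; if_then_else_)
open import Data.Bool.Properties renaming (_≟_ to _≟ᵇ_)
open import Data.Fin using (Fin)
open import Data.Fin.Subset using (Subset; _⊆_; _∈_; _∉_; ∣_∣; _-_; _∩_; ⊥)
open import Data.Fin.Subset.Properties using (_⊆?_)
open import Data.Vec using (zipWith)
open import Data.Vec.Properties using (≡-dec)
open import Data.List using (List; []; _∷_; length; filter; map)
open import Data.List.Membership.Propositional using () renaming (_∈_ to _∈ₗ_)
open import Data.List.Relation.Binary.Permutation.Propositional using (_↭_)
open import Data.Product using (Σ; _×_; _,_; proj₁; proj₂)
open import Relation.Nullary using (¬_; Dec; yes; no)
open import Relation.Binary.PropositionalEquality using (_≡_; _≢_)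

-- Blocks are subsets of V = Fin n; multisets of blocks are lists
-- (considered up to permutation, i.e. _↭_).

_≟ₛ_ : ∀ {n} (A B : Subset n) → Dec (A ≡ B)
_≟ₛ_ = ≡-dec _≟ᵇ_

-- symmetric difference (juxtaposition in the paper)
_⊕_ : ∀ {n} → Subset n → Subset n → Subset n
A ⊕ B = zipWith _xor_ A B

infixl 6 _⊕_

Multiset : ℕ → Set
Multiset n = List (Subset n)

Pair : ℕ → Set
Pair n = Multiset n × Multiset n

cnt : ∀ {n} → Subset n → Multiset n → ℕ
cnt S L = length (filter (S ⊆?_) L)

IsTrade : ∀ {n} → ℕ → Pair n → Set
IsTrade {n} t (P , M) =
  (∀ (B : Subset n) → B ∈ₗ P → ¬ (B ∈ₗ M)) ×
  (∀ (i : ℕ) → i ≤ t → ∀ (S : Subset n) → ∣ S ∣ ≡ i → cnt S P ≡ cnt S M)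

volume : ∀ {n} → Pair n → ℕ
volume (P , M) = length P

_≈ₚ_ : ∀ {n} → Pair n → Pair n → Set
(P , M) ≈ₚ (P' , M') = (P ↭ P') × (M ↭ M')

shift : ∀ {n} → Subset n → Pair n → Pair n
shift Y (P , M) = map (Y ⊕_) P , map (Y ⊕_) M

removeOne : ∀ {n} → Subset n → Multiset n → Multiset n
removeOne B [] = []
removeOne B (C ∷ L) with B ≟ₛ C
... | yes _ = L
... | no  _ = C ∷ removeOne B L

member : ∀ {n} → Subset n → Multiset n → Bool
member B [] = false
member B (C ∷ L) with B ≟ₛ C
... | yes _ = true
... | no  _ = member B L

cancel : ∀ {n} → Multiset n → Multiset n → Pair n
cancel [] M = [] , M
cancel (B ∷ P) M with member B M
... | true  = cancel P (removeOne B M)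
... | false = let r = cancel P M in (B ∷ proj₁ r) , proj₂ r

projection : ∀ {n} → Fin n → Pair n → Pair n
projection s (P , M) = cancel (map (_- s) P) (map (_- s) M)

Avoids : ∀ {n} → Fin n → Pair n → Set
Avoids {n} s (P , M) = ∀ (B : Subset n) → (B ∈ₗ P → s ∉ B) × (B ∈ₗ M → s ∉ B)

IsExtension : ∀ {n} → ℕ → Pair n → Pair n → Set
IsExtension {n} t T T' =
  IsTrade t T' ×
  Σ (Fin n) (λ s → Avoids s T × (projection s T' ≈ₚ T)) ×
  (volume T' ≡ volume T)

Disjoint : ∀ {n} → Subset n → Subset n → Set
Disjoint A B = A ∩ B ≡ ⊥

form : ∀ {n} (X Y₁ Y₂ Y₃ Z₁ Z₂ Z₃ : Subset n) → Pair n
form X Y₁ Y₂ Y₃ Z₁ Z₂ Z₃ =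
  (Y₁ ∷ Y₂ ∷ Y₃ ∷ X ⊕ Z₁ ∷ X ⊕ Z₂ ∷ X ⊕ Z₃ ∷ []) ,
  (Z₁ ∷ Z₂ ∷ Z₃ ∷ X ⊕ Y₁ ∷ X ⊕ Y₂ ∷ X ⊕ Y₃ ∷ [])

FormConditions : ∀ {n} (X Y₁ Y₂ Y₃ Z₁ Z₂ Z₃ : Subset n) → Set
FormConditions X Y₁ Y₂ Y₃ Z₁ Z₂ Z₃ =
  (Disjoint X Y₁ × Disjoint X Y₂ × Disjoint X Y₃ ×
   Disjoint Y₁ Y₂ × Disjoint Y₁ Y₃ × Disjoint Y₂ Y₃) ×
  (Disjoint X Z₁ × Disjoint X Z₂ × Disjoint X Z₃ ×
   Disjoint Z₁ Z₂ × Disjoint Z₁ Z₃ × Disjoint Z₂ Z₃) ×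
  (Y₁ ⊕ Y₂ ⊕ Y₃ ≡ Z₁ ⊕ Z₂ ⊕ Z₃) ×
  (Y₁ ≢ Z₁ × Y₁ ≢ Z₂ × Y₁ ≢ Z₃ ×
   Y₂ ≢ Z₁ × Y₂ ≢ Z₂ × Y₂ ≢ Z₃ ×
   Y₃ ≢ Z₁ × Y₃ ≢ Z₂ × Y₃ ≢ Z₃) ×
  (X ≢ ⊥)

-- The projection of T' at s has the volume of T, so it cancels nothing: every block of T'
-- is a block of T into which s may have been put, and T' is T lifted along twelve bits.
-- Counting the blocks through {s} and through {s , e}, for e in X or in a nonempty cell
-- Y_i ∩ Z_j, turns the [2]-trade condition into linear equations on these bits, and the
-- hypotheses on X, Y_i, Z_j guarantee enough nonempty cells. A finite check shows that then,
-- after possibly exchanging the lifts of two empty Y_i (or two empty Z_j), the equation of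
-- every cell holds; such a lifting is the {s}-shift (or ∅-shift) of the same form built from
-- X, Y_i, Z_j with s put into some of them.
module Submission where

open import Defs
open import Data.Nat using (ℕ; zero; suc; _+_; _≤_; z≤n; s≤s)
open import Data.Fin.Subset using (Subset; _∈_; _∉_; _⊆_; ∣_∣; _-_; _∩_; _∪_; ⁅_⁆; ⊥)
open import Data.Product using (Σ; _×_; ∃; ∃₂; _,_; proj₁; proj₂)

open import Data.Bool using (Bool; true; false; not; _∧_; _∨_; _xor_; T)
open import Data.Bool.Properties
  using (¬-not; ∧-conicalˡ; ∧-conicalʳ; ∧-idem; ∧-comm; xor-identityˡ; xor-identityʳ; T-≡; T-∧)
  renaming (_≟_ to _≟ᵇ_)
open import Data.Empty using (⊥-elim)
open import Data.Fin using (Fin; zero; suc)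
open import Data.Fin.Patterns using (0F; 1F; 2F)
open import Data.Fin.Properties using (¬∀⟶∃¬) renaming (_≟_ to _≟ᶠ_)
open import Data.Fin.Subset.Properties using (_⊆?_; x∈⁅x⁆; x∈⁅y⁆⇒x≡y; x∈p∪q⁻; x∈p∪q⁺; ∣⁅x⁆∣≡1; p─⊥≡p)
open import Data.List using (List; []; _∷_; _++_; length; filter)
import Data.List as List
open import Data.List.Properties
  using (length-map; length-++; filter-++; ∷-injectiveˡ; ∷-injectiveʳ; ++-identityʳ; map-++)
open import Data.List.Relation.Binary.Permutation.Propositional
  using (_↭_; ↭-refl; ↭-sym; ↭-trans; prep) renaming (swap to ↭-swap)
open import Data.List.Relation.Binary.Permutation.Propositional.Properties
  using (↭-length; filter-↭; ↭-map-inv; ++⁺ʳ)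
open import Data.List.Relation.Unary.Any using (here; there)
open import Data.Nat.Properties
  using (suc-injective; ≤-trans; ≤-reflexive; +-suc; +-monoʳ-≤; +-identityʳ; n≤1+n; 1+n≰n)
  renaming (_≟_ to _≟ℕ_)
import Data.Product.Properties as Product
open import Data.Sum using (_⊎_; inj₁; inj₂; [_,_]′)
open import Data.Vec using (Vec; []; _∷_; lookup; map; zipWith; replicate; sum; toList; _[_]≔_)
open import Data.Vec.Properties
  using ( lookup-zipWith; lookup-replicate; lookup-map; map-∘; map-cong; map-id; zipWith-identityˡ
        ; []≔-idempotent; []≔-lookup; lookup∘update; lookup∘update′; []=⇒lookup; lookup⇒[]=)
import Data.Vec.Properties as Vec
open import Data.Vec.Relation.Binary.Pointwise.Extensional using (ext; Pointwise-≡⇒≡)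
open import Data.Vec.Relation.Unary.All using (All; []; _∷_)
open import Data.Vec.Relation.Unary.AllPairs using (AllPairs; []; _∷_; allPairs?) renaming (map to allPairs-map)
open import Data.Vec.Relation.Unary.AllPairs.Properties using (map⁺)
open import Function using (_∘_; _⇔_; mk⇔; Equivalence)
open import Relation.Binary.PropositionalEquality
  using (_≡_; _≢_; refl; sym; trans; cong; cong₂; subst; module ≡-Reasoning)
open import Relation.Nullary using (Dec; yes; no; does; _because_; invert)
open import Relation.Nullary.Decidable
  using (_×-dec_; _⊎-dec_; _→-dec_; ¬?; map′; T?; does-⇔; dec-true; dec-false)

private variable
  n k : ℕ

-- Deciding statements about finitely many bits

-- Stated with `≡ true` rather than `T`: checking `refl` then evaluates the closed enumeration
-- once, whereas a `T` in a type gets unfolded whenever the type is compared.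
decided : ∀ {P : Set} (P? : Dec P) → does P? ≡ true → P
decided (true because [p]) _ = invert [p]

allᵇ : (Bool → Bool) → Bool
allᵇ f = f true ∧ f false

allᵇ-sound : ∀ f → allᵇ f ≡ true → ∀ b → f b ≡ true
allᵇ-sound f all≡true true  = ∧-conicalˡ _ _ all≡true
allᵇ-sound f all≡true false = ∧-conicalʳ _ _ all≡true

allᵛ : (Vec Bool k → Bool) → Bool
allᵛ {zero}  f = f []
allᵛ {suc k} f = allᵇ λ b → allᵛ (f ∘ (b ∷_))

allᵛ-sound : ∀ f → allᵛ {k} f ≡ true → ∀ v → f v ≡ true
allᵛ-sound f all≡true []      = all≡true
allᵛ-sound f all≡true (b ∷ v) = allᵛ-sound (f ∘ (b ∷_)) (allᵇ-sound (λ b → allᵛ (f ∘ (b ∷_))) all≡true b) v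

∀³? : ∀ {P : Fin 3 → Set} → (∀ i → Dec (P i)) → Dec (∀ i → P i)
∀³? P? = map′ (λ { (p , q , r) 0F → p ; (p , q , r) 1F → q ; (p , q , r) 2F → r })
              (λ f → f 0F , f 1F , f 2F)
              (P? 0F ×-dec P? 1F ×-dec P? 2F)

∃³? : ∀ {P : Fin 3 → Set} → (∀ i → Dec (P i)) → Dec (∃ P)
∃³? P? = map′ (λ { (inj₁ p) → 0F , p ; (inj₂ (inj₁ q)) → 1F , q ; (inj₂ (inj₂ r)) → 2F , r })
              (λ { (0F , p) → inj₁ p ; (1F , q) → inj₂ (inj₁ q) ; (2F , r) → inj₂ (inj₂ r) })
              (P? 0F ⊎-dec P? 1F ⊎-dec P? 2F)

toℕ : Bool → ℕ
toℕ false = 0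
toℕ true  = 1

ones : Vec Bool k → ℕ
ones v = sum (map toℕ v)

dot : Vec Bool k → Vec Bool k → ℕ
dot u v = sum (zipWith (λ p q → toℕ (p ∧ q)) u v)

Exclusive : Vec Bool k → Set
Exclusive = AllPairs (λ p q → p ∧ q ≡ false)

exclusive? : (v : Vec Bool k) → Dec (Exclusive v)
exclusive? = allPairs? (λ p q → p ∧ q ≟ᵇ false)

parity : Vec Bool 3 → Bool
parity (p ∷ q ∷ r ∷ []) = (p xor q) xor r

majority : Vec Bool 3 → Bool
majority (p ∷ q ∷ r ∷ []) = p ∧ q ∨ p ∧ r ∨ q ∧ r

-- The combinatorial core

-- The memberships of an element in X, in Y₁ Y₂ Y₃ and in Z₁ Z₂ Z₃.
Pattern : Set
Pattern = Bool × Vec Bool 3 × Vec Bool 3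

zeros : Vec Bool 3
zeros = replicate 3 false

unit : Fin 3 → Vec Bool 3
unit i = zeros [ i ]≔ true

inNone inX : Pattern
inNone = false , zeros , zeros
inX    = true , zeros , zeros

inYZ : Fin 3 → Fin 3 → Pattern
inYZ i j = false , unit i , unit j

allPatterns : (Pattern → Bool) → Bool
allPatterns f = allᵇ λ x → allᵛ λ y → allᵛ λ z → f (x , y , z)

allPatterns-sound : ∀ f → allPatterns f ≡ true → ∀ p → f p ≡ true
allPatterns-sound f all≡true (x , y , z) =
  allᵛ-sound (λ z → f (x , y , z))
    (allᵛ-sound (λ y → allᵛ λ z → f (x , y , z))
      (allᵇ-sound (λ x → allᵛ λ y → allᵛ λ z → f (x , y , z)) all≡true x) y) z

Valid : Pattern → Set
Valid (x , y , z) = Exclusive (x ∷ y) × Exclusive (x ∷ z) × parity y ≡ parity z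

Shape : Pattern → Set
Shape p = p ≡ inNone ⊎ p ≡ inX ⊎ ∃₂ λ i j → p ≡ inYZ i j

classify : ∀ p → Valid p → Shape p
classify p = decided (valid? p →-dec shape? p) (allPatterns-sound (λ p → does (valid? p →-dec shape? p)) refl p)
  where
  valid? : ∀ p → Dec (Valid p)
  valid? (x , y , z) = exclusive? (x ∷ y) ×-dec exclusive? (x ∷ z) ×-dec parity y ≟ᵇ parity z
  _≟ₚ_ : (p q : Pattern) → Dec (p ≡ q)
  _≟ₚ_ = Product.≡-dec _≟ᵇ_ (Product.≡-dec (Vec.≡-dec _≟ᵇ_) (Vec.≡-dec _≟ᵇ_))
  shape? : ∀ p → Dec (Shape p)
  shape? p = p ≟ₚ inNone ⊎-dec p ≟ₚ inX ⊎-dec ∃³? λ i → ∃³? λ j → p ≟ₚ inYZ i j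

-- Which blocks of the extension contain s: a i for Y_i, b j for X ⊕ Z_j, c j for Z_j and
-- d i for X ⊕ Y_i.
record Lifting : Set where
  constructor lifting
  field a b c d : Vec Bool 3
open Lifting

allLiftings : (Lifting → Bool) → Bool
allLiftings f = allᵛ λ a → allᵛ λ b → allᵛ λ c → allᵛ λ d → f (lifting a b c d)

allLiftings-sound : ∀ f → allLiftings f ≡ true → ∀ L → f L ≡ true
allLiftings-sound f all≡true (lifting a b c d) =
  allᵛ-sound (λ d → f (lifting a b c d)) (allᵛ-sound (λ c → allᵛ λ d → f (lifting a b c d))
    (allᵛ-sound (λ b → allᵛ λ c → allᵛ λ d → f (lifting a b c d))
      (allᵛ-sound (λ a → allᵛ λ b → allᵛ λ c → allᵛ λ d → f (lifting a b c d)) all≡true a) b) c) d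

count₊ count₋ : Lifting → Pattern → ℕ
count₊ L (x , y , z) = dot y (a L) + dot (map (x xor_) z) (b L)
count₋ L (x , y , z) = dot z (c L) + dot (map (x xor_) y) (d L)

Balanced : Lifting → Pattern → Set
Balanced L p = count₊ L p ≡ count₋ L p

Balancedₛ : Lifting → Set
Balancedₛ L = ones (a L) + ones (b L) ≡ ones (c L) + ones (d L)

BalancedAt : Lifting → Fin 3 → Fin 3 → Set
BalancedAt L i j = toℕ (lookup (a L) i) + toℕ (lookup (b L) j) ≡ toℕ (lookup (c L) j) + toℕ (lookup (d L) i)

Complete : Lifting → Set
Complete L = ∀ i j → BalancedAt L i j

dot-unit : ∀ i v → dot (unit i) v ≡ toℕ (lookup v i)
dot-unit 0F (p ∷ q ∷ r ∷ []) = +-identityʳ (toℕ p)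
dot-unit 1F (p ∷ q ∷ r ∷ []) = +-identityʳ (toℕ q)
dot-unit 2F (p ∷ q ∷ r ∷ []) = +-identityʳ (toℕ r)

count-inYZ : ∀ (u v : Vec Bool 3) i j →
             dot (unit i) u + dot (map (false xor_) (unit j)) v ≡ toℕ (lookup u i) + toℕ (lookup v j)
count-inYZ u v i j = cong₂ _+_ (dot-unit i u) (trans (cong (λ w → dot w v) (map-id (unit j))) (dot-unit j v))

balanced⇒balancedAt : ∀ L i j → Balanced L (inYZ i j) → BalancedAt L i j
balanced⇒balancedAt L i j balanced =
  trans (sym (count-inYZ (a L) (b L) i j)) (trans balanced (count-inYZ (c L) (d L) j i))

record Emptiness : Set where
  constructor emptiness
  field emptyY emptyZ : Vec Bool 3
open Emptiness

allEmptiness : (Emptiness → Bool) → Bool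
allEmptiness f = allᵛ λ y → allᵛ λ z → f (emptiness y z)

allEmptiness-sound : ∀ f → allEmptiness f ≡ true → ∀ E → f E ≡ true
allEmptiness-sound f all≡true (emptiness y z) =
  allᵛ-sound (λ z → f (emptiness y z)) (allᵛ-sound (λ y → allᵛ λ z → f (emptiness y z)) all≡true y) z

Edge : Lifting → Emptiness → Fin 3 → Fin 3 → Set
Edge L E k l = lookup (emptyY E) k ≡ false × lookup (emptyZ E) l ≡ false × BalancedAt L k l

-- What the conditions on X, Y_i, Z_j reveal through the nonempty cells Y_k ∩ Z_l (the edges):
-- every Y_i ≠ Z_j is told apart by a cell, and every nonempty Y_i or Z_j meets a cell.
Witnessed : Lifting → Emptiness → Set
Witnessed L E =
    (∀ i j → ∃₂ λ k l → lookup (unit k) i ≢ lookup (unit l) j × Edge L E k l)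
  × (∀ i → lookup (emptyY E) i ≡ true ⊎ ∃₂ λ k l → lookup (unit k) i ≡ true × Edge L E k l)
  × (∀ j → lookup (emptyZ E) j ≡ true ⊎ ∃₂ λ k l → lookup (unit l) j ≡ true × Edge L E k l)

swap : Fin 3 → Fin 3 → Vec Bool 3 → Vec Bool 3
swap i k v = v [ i ]≔ lookup v k [ k ]≔ lookup v i

-- Two empty blocks are equal, so their lifts may be exchanged.
Relabelling : Lifting → Emptiness → Set
Relabelling L E = Complete L
  ⊎ (∃₂ λ i k → i ≢ k × lookup (emptyY E) i ≡ true × lookup (emptyY E) k ≡ true
                × Complete (record L { a = swap i k (a L) }))
  ⊎ (∃₂ λ j l → j ≢ l × lookup (emptyZ E) j ≡ true × lookup (emptyZ E) l ≡ true
                × Complete (record L { c = swap j l (c L) }))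

balanced⇒relabelling : ∀ L E → Balancedₛ L → Balanced L inX → Witnessed L E → Relabelling L E
balanced⇒relabelling L E = decided (decision L E)
  (allEmptiness-sound (does ∘ decision L) (allLiftings-sound (λ L → allEmptiness (does ∘ decision L)) refl L) E)
  where
  balancedAt? : ∀ L i j → Dec (BalancedAt L i j)
  balancedAt? L i j = _ ≟ℕ _
  complete? : ∀ L → Dec (Complete L)
  complete? L = ∀³? λ i → ∀³? λ j → balancedAt? L i j
  edge? : ∀ L E k l → Dec (Edge L E k l)
  edge? L E k l = lookup (emptyY E) k ≟ᵇ false ×-dec lookup (emptyZ E) l ≟ᵇ false ×-dec balancedAt? L k l
  witnessed? : ∀ L E → Dec (Witnessed L E)
  witnessed? L E =
          ∀³? (λ i → ∀³? λ j → ∃³? λ k → ∃³? λ l →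
                  ¬? (lookup (unit k) i ≟ᵇ lookup (unit l) j) ×-dec edge? L E k l)
    ×-dec ∀³? (λ i → lookup (emptyY E) i ≟ᵇ true ⊎-dec ∃³? λ k → ∃³? λ l →
                  lookup (unit k) i ≟ᵇ true ×-dec edge? L E k l)
    ×-dec ∀³? (λ j → lookup (emptyZ E) j ≟ᵇ true ⊎-dec ∃³? λ k → ∃³? λ l →
                  lookup (unit l) j ≟ᵇ true ×-dec edge? L E k l)
  relabelling? : ∀ L E → Dec (Relabelling L E)
  relabelling? L E = complete? L
    ⊎-dec ∃³? (λ i → ∃³? λ k → ¬? (i ≟ᶠ k) ×-dec lookup (emptyY E) i ≟ᵇ true ×-dec lookup (emptyY E) k ≟ᵇ true
                                  ×-dec complete? (record L { a = swap i k (a L) }))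
    ⊎-dec ∃³? (λ j → ∃³? λ l → ¬? (j ≟ᶠ l) ×-dec lookup (emptyZ E) j ≟ᵇ true ×-dec lookup (emptyZ E) l ≟ᵇ true
                                  ×-dec complete? (record L { c = swap j l (c L) }))
  decision : ∀ L E → Dec (Balancedₛ L → Balanced L inX → Witnessed L E → Relabelling L E)
  decision L E = _ ≟ℕ _ →-dec _ ≟ℕ _ →-dec witnessed? L E →-dec relabelling? L E

-- L lifts the shift by {s} (if σ) of the form with s put into X (if x), into Y_i (if α i)
-- and into Z_j (if β j).
Decomposition : Lifting → Bool → Bool → Vec Bool 3 → Vec Bool 3 → Set
Decomposition L σ x α β = Exclusive (x ∷ α) × Exclusive (x ∷ β) × parity α ≡ parity β
  × a L ≡ map (σ xor_) α × b L ≡ map (σ xor_) (map (x xor_) β)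
  × c L ≡ map (σ xor_) β × d L ≡ map (σ xor_) (map (x xor_) α)

complete⇒decomposition : ∀ L → Balancedₛ L → Balanced L inX → Complete L →
                         ∃ λ σ → ∃ λ x → ∃₂ λ α β → Decomposition L σ x α β
complete⇒decomposition L balancedₛ balancedₓ complete =
  σ L , x L , α L , β L ,
  decided (decision L) (allLiftings-sound (does ∘ decision) refl L) balancedₛ balancedₓ complete
  where
  σ x : Lifting → Bool
  σ L = majority (a L)
  x L = lookup (a L) 0F xor lookup (d L) 0F
  α β : Lifting → Vec Bool 3
  α L = map (_xor σ L) (a L)
  β L = map (_xor σ L) (c L)
  _≟ᵛ_ : (u v : Vec Bool 3) → Dec (u ≡ v)
  _≟ᵛ_ = Vec.≡-dec _≟ᵇ_
  decision : ∀ L → Dec (Balancedₛ L → Balanced L inX → Complete L → Decomposition L (σ L) (x L) (α L) (β L))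
  decision L = _ ≟ℕ _ →-dec _ ≟ℕ _ →-dec (∀³? λ i → ∀³? λ j → _ ≟ℕ _) →-dec
    exclusive? (x L ∷ α L) ×-dec exclusive? (x L ∷ β L) ×-dec parity (α L) ≟ᵇ parity (β L)
    ×-dec a L ≟ᵛ _ ×-dec b L ≟ᵛ _ ×-dec c L ≟ᵛ _ ×-dec d L ≟ᵛ _

-- Subsets, counts and projections

lookup-⊕ : ∀ (A B : Subset n) i → lookup (A ⊕ B) i ≡ lookup A i xor lookup B i
lookup-⊕ A B i = lookup-zipWith _xor_ i A B

lookup-⊥ : ∀ (i : Fin n) → lookup ⊥ i ≡ false
lookup-⊥ i = lookup-replicate i false

lookup-disjoint : ∀ {A B : Subset n} → Disjoint A B → ∀ i → lookup A i ∧ lookup B i ≡ false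
lookup-disjoint {A = A} {B} A∩B≡⊥ i =
  trans (sym (lookup-zipWith _∧_ i A B)) (trans (cong (λ C → lookup C i) A∩B≡⊥) (lookup-⊥ i))

true≢false : true ≢ false
true≢false ()

≢⇒true⊎true : ∀ {p q} → p ≢ q → p ≡ true ⊎ q ≡ true
≢⇒true⊎true {true}          _   = inj₁ refl
≢⇒true⊎true {false} {true}  _   = inj₂ refl
≢⇒true⊎true {false} {false} p≢q = ⊥-elim (p≢q refl)

∉⇒lookup≡false : ∀ {i : Fin n} {C} → i ∉ C → lookup C i ≡ false
∉⇒lookup≡false {i = i} {C} i∉C with lookup C i in eq
... | true  = ⊥-elim (i∉C (lookup⇒[]= i C eq))
... | false = refl

lookup≡true⇒≢ : ∀ {C : Subset n} {s e} → s ∉ C → lookup C e ≡ true → e ≢ s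
lookup≡true⇒≢ s∉C e∈C refl = true≢false (trans (sym e∈C) (∉⇒lookup≡false s∉C))

∉-⊕ : ∀ {A B : Subset n} {i} → i ∉ A ⊕ B → i ∉ B → i ∉ A
∉-⊕ {A = A} {B} {i} i∉A⊕B i∉B i∈A = true≢false (begin
  true                        ≡⟨ sym ([]=⇒lookup i∈A) ⟩
  lookup A i                  ≡⟨ sym (xor-identityʳ _) ⟩
  lookup A i xor false        ≡⟨ cong (lookup A i xor_) (sym (∉⇒lookup≡false i∉B)) ⟩
  lookup A i xor lookup B i   ≡⟨ sym (lookup-⊕ A B i) ⟩
  lookup (A ⊕ B) i            ≡⟨ ∉⇒lookup≡false i∉A⊕B ⟩
  false                       ∎)
  where open ≡-Reasoning

≢⇒lookup≢ : ∀ {A B : Subset n} → A ≢ B → ∃ λ i → lookup A i ≢ lookup B i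
≢⇒lookup≢ {n} {A} {B} A≢B = ¬∀⟶∃¬ n _ (λ i → lookup A i ≟ᵇ lookup B i) (A≢B ∘ Pointwise-≡⇒≡ ∘ ext)

nonempty⇒element : ∀ {C : Subset n} → C ≢ ⊥ → ∃ λ e → lookup C e ≡ true
nonempty⇒element C≢⊥ with ≢⇒lookup≢ C≢⊥
... | e , differ = e , trans (¬-not differ) (cong not (lookup-⊥ e))

zipWith-[]≔ : ∀ {A : Set} (f : A → A → A) (u v : Vec A n) i x y →
              zipWith f (u [ i ]≔ x) (v [ i ]≔ y) ≡ zipWith f u v [ i ]≔ f x y
zipWith-[]≔ f (_ ∷ u) (_ ∷ v) zero    x y = refl
zipWith-[]≔ f (p ∷ u) (q ∷ v) (suc i) x y = cong (f p q ∷_) (zipWith-[]≔ f u v i x y)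

-≡[]≔false : ∀ (C : Subset n) i → C - i ≡ C [ i ]≔ false
-≡[]≔false (_ ∷ C) zero    = cong (false ∷_) (p─⊥≡p C)
-≡[]≔false (p ∷ C) (suc i) = cong (p ∷_) (-≡[]≔false C i)

⊥[]≔false : ∀ (i : Fin n) → ⊥ [ i ]≔ false ≡ ⊥
⊥[]≔false i = subst (λ b → ⊥ [ i ]≔ b ≡ ⊥) (lookup-⊥ i) ([]≔-lookup ⊥ i)

∣p∪q∣≤∣p∣+∣q∣ : ∀ (p q : Subset n) → ∣ p ∪ q ∣ ≤ ∣ p ∣ + ∣ q ∣
∣p∪q∣≤∣p∣+∣q∣ []          []          = z≤n
∣p∪q∣≤∣p∣+∣q∣ (true ∷ p)  (true ∷ q)  = s≤s (≤-trans (∣p∪q∣≤∣p∣+∣q∣ p q) (+-monoʳ-≤ ∣ p ∣ (n≤1+n ∣ q ∣)))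
∣p∪q∣≤∣p∣+∣q∣ (true ∷ p)  (false ∷ q) = s≤s (∣p∪q∣≤∣p∣+∣q∣ p q)
∣p∪q∣≤∣p∣+∣q∣ (false ∷ p) (true ∷ q)  = ≤-trans (s≤s (∣p∪q∣≤∣p∣+∣q∣ p q)) (≤-reflexive (sym (+-suc ∣ p ∣ ∣ q ∣)))
∣p∪q∣≤∣p∣+∣q∣ (false ∷ p) (false ∷ q) = ∣p∪q∣≤∣p∣+∣q∣ p q

∣⁅x⁆∪⁅y⁆∣≤2 : ∀ (x y : Fin n) → ∣ ⁅ x ⁆ ∪ ⁅ y ⁆ ∣ ≤ 2
∣⁅x⁆∪⁅y⁆∣≤2 x y = subst (∣ ⁅ x ⁆ ∪ ⁅ y ⁆ ∣ ≤_) (cong₂ _+_ (∣⁅x⁆∣≡1 x) (∣⁅x⁆∣≡1 y)) (∣p∪q∣≤∣p∣+∣q∣ ⁅ x ⁆ ⁅ y ⁆)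

⁅x⁆∪⁅y⁆⊆⇔ : ∀ {x y : Fin n} {B} → (⁅ x ⁆ ∪ ⁅ y ⁆ ⊆ B) ⇔ T (lookup B x ∧ lookup B y)
⁅x⁆∪⁅y⁆⊆⇔ {x = x} {y} {B} = mk⇔ to from
  where
  T-lookup : ∀ {i} → i ∈ B → T (lookup B i)
  T-lookup = Equivalence.from T-≡ ∘ []=⇒lookup
  ∈B : ∀ {i} → T (lookup B i) → i ∈ B
  ∈B {i} = lookup⇒[]= i B ∘ Equivalence.to T-≡
  to : ⁅ x ⁆ ∪ ⁅ y ⁆ ⊆ B → T (lookup B x ∧ lookup B y)
  to ⊆B = Equivalence.from (T-∧ {lookup B x})
            (T-lookup (⊆B (x∈p∪q⁺ (inj₁ (x∈⁅x⁆ x)))) , T-lookup (⊆B (x∈p∪q⁺ (inj₂ (x∈⁅x⁆ y)))))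
  from : T (lookup B x ∧ lookup B y) → ⁅ x ⁆ ∪ ⁅ y ⁆ ⊆ B
  from t i∈ with Equivalence.to (T-∧ {lookup B x}) t | x∈p∪q⁻ ⁅ x ⁆ ⁅ y ⁆ i∈
  ... | tx , _  | inj₁ i∈⁅x⁆ rewrite x∈⁅y⁆⇒x≡y x i∈⁅x⁆ = ∈B tx
  ... | _  , ty | inj₂ i∈⁅y⁆ rewrite x∈⁅y⁆⇒x≡y y i∈⁅y⁆ = ∈B ty

cnt-∷ : ∀ (S B : Subset n) L → cnt S (B ∷ L) ≡ toℕ (does (S ⊆? B)) + cnt S L
cnt-∷ S B L with does (S ⊆? B)
... | true  = refl
... | false = refl

cnt-++ : ∀ (S : Subset n) L M → cnt S (L ++ M) ≡ cnt S L + cnt S M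
cnt-++ S L M = trans (cong length (filter-++ (S ⊆?_) L M)) (length-++ (filter (S ⊆?_) L))

cnt-↭ : ∀ (S : Subset n) {L M} → L ↭ M → cnt S L ≡ cnt S M
cnt-↭ S L↭M = ↭-length (filter-↭ (S ⊆?_) L↭M)

cnt-pair : ∀ (x y : Fin n) B L →
           cnt (⁅ x ⁆ ∪ ⁅ y ⁆) (B ∷ L) ≡ toℕ (lookup B x ∧ lookup B y) + cnt (⁅ x ⁆ ∪ ⁅ y ⁆) L
cnt-pair x y B L = trans (cnt-∷ _ B L) (cong (λ b → toℕ b + _) (does-⇔ ⁅x⁆∪⁅y⁆⊆⇔ (_ ⊆? B) (T? _)))

cancel-length : ∀ (P M : Multiset n) → length (proj₁ (cancel P M)) ≤ length P
cancel-length []      M = z≤n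
cancel-length (B ∷ P) M with member B M
... | true  = ≤-trans (cancel-length P (removeOne B M)) (n≤1+n (length P))
... | false = s≤s (cancel-length P M)

cancel-trivial : ∀ (P M : Multiset n) → length (proj₁ (cancel P M)) ≡ length P → cancel P M ≡ (P , M)
cancel-trivial []      M _ = refl
cancel-trivial (B ∷ P) M eq with member B M
... | true  = ⊥-elim (1+n≰n (subst (_≤ length P) eq (cancel-length P (removeOne B M))))
... | false = cong (λ r → B ∷ proj₁ r , proj₂ r) (cancel-trivial P M (suc-injective eq))

projection-trivial : ∀ (s : Fin n) {T T' : Pair n} → projection s T' ≈ₚ T → volume T' ≡ volume T →
                     (List.map (_- s) (proj₁ T') ↭ proj₁ T) × (List.map (_- s) (proj₂ T') ↭ proj₂ T)
projection-trivial s {T₊ , T₋} {P , M} (P↭ , M↭) volume≡ =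
  subst (λ r → proj₁ r ↭ T₊ × proj₂ r ↭ T₋) (cancel-trivial _ _ same-length) (P↭ , M↭)
  where
  same-length : length (proj₁ (cancel (List.map (_- s) P) (List.map (_- s) M))) ≡ length (List.map (_- s) P)
  same-length = trans (↭-length P↭) (sym (trans (length-map (_- s) P) volume≡))

-- The six-block trades and their extensions

formᵛ : Subset n → Vec (Subset n) 3 → Vec (Subset n) 3 → Pair n
formᵛ X Y Z = toList Y ++ toList (map (X ⊕_) Z) , toList Z ++ toList (map (X ⊕_) Y)

⨁ : Vec (Subset n) 3 → Subset n
⨁ (A ∷ B ∷ C ∷ []) = A ⊕ B ⊕ C

lookup-⨁ : ∀ (Cs : Vec (Subset n) 3) e → lookup (⨁ Cs) e ≡ parity (map (λ C → lookup C e) Cs)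
lookup-⨁ (A ∷ B ∷ C ∷ []) e = trans (lookup-⊕ (A ⊕ B) C e) (cong (_xor lookup C e) (lookup-⊕ A B e))

record Conditions (X : Subset n) (Y Z : Vec (Subset n) 3) : Set where
  field
    disjointY : AllPairs Disjoint (X ∷ Y)
    disjointZ : AllPairs Disjoint (X ∷ Z)
    sums      : ⨁ Y ≡ ⨁ Z
    distinct  : ∀ i j → lookup Y i ≢ lookup Z j
    nonempty  : X ≢ ⊥

fromFormConditions : ∀ {X Y₁ Y₂ Y₃ Z₁ Z₂ Z₃ : Subset n} → FormConditions X Y₁ Y₂ Y₃ Z₁ Z₂ Z₃ →
                     Conditions X (Y₁ ∷ Y₂ ∷ Y₃ ∷ []) (Z₁ ∷ Z₂ ∷ Z₃ ∷ [])
fromFormConditions ((dXY₁ , dXY₂ , dXY₃ , dY₁₂ , dY₁₃ , dY₂₃) , (dXZ₁ , dXZ₂ , dXZ₃ , dZ₁₂ , dZ₁₃ , dZ₂₃) , sums ,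
                    (Y₁≢Z₁ , Y₁≢Z₂ , Y₁≢Z₃ , Y₂≢Z₁ , Y₂≢Z₂ , Y₂≢Z₃ , Y₃≢Z₁ , Y₃≢Z₂ , Y₃≢Z₃) , X≢⊥) = record
  { disjointY = (dXY₁ ∷ dXY₂ ∷ dXY₃ ∷ []) ∷ (dY₁₂ ∷ dY₁₃ ∷ []) ∷ (dY₂₃ ∷ []) ∷ [] ∷ []
  ; disjointZ = (dXZ₁ ∷ dXZ₂ ∷ dXZ₃ ∷ []) ∷ (dZ₁₂ ∷ dZ₁₃ ∷ []) ∷ (dZ₂₃ ∷ []) ∷ [] ∷ []
  ; sums      = sums
  ; distinct  = λ where
      0F 0F → Y₁≢Z₁ ; 0F 1F → Y₁≢Z₂ ; 0F 2F → Y₁≢Z₃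
      1F 0F → Y₂≢Z₁ ; 1F 1F → Y₂≢Z₂ ; 1F 2F → Y₂≢Z₃
      2F 0F → Y₃≢Z₁ ; 2F 1F → Y₃≢Z₂ ; 2F 2F → Y₃≢Z₃
  ; nonempty  = X≢⊥
  }

ShiftOfForm : Pair n → Set
ShiftOfForm {n} T' =
  Σ (Subset n) λ Y → Σ (Subset n) λ X' →
  Σ (Subset n) λ Y₁' → Σ (Subset n) λ Y₂' → Σ (Subset n) λ Y₃' →
  Σ (Subset n) λ Z₁' → Σ (Subset n) λ Z₂' → Σ (Subset n) λ Z₃' →
    FormConditions X' Y₁' Y₂' Y₃' Z₁' Z₂' Z₃' ×
    (T' ≈ₚ shift Y (form X' Y₁' Y₂' Y₃' Z₁' Z₂' Z₃'))

shiftOfForm : ∀ {T' : Pair n} Y {X'} {Y' Z' : Vec (Subset n) 3} → Conditions X' Y' Z' →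
              T' ≈ₚ shift Y (formᵛ X' Y' Z') → ShiftOfForm T'
shiftOfForm Y {X'} {Y₁ ∷ Y₂ ∷ Y₃ ∷ []} {Z₁ ∷ Z₂ ∷ Z₃ ∷ []} conditions T'≈ =
  Y , X' , Y₁ , Y₂ , Y₃ , Z₁ , Z₂ , Z₃ , formConditions , T'≈
  where
  open Conditions conditions
  formConditions : FormConditions X' Y₁ Y₂ Y₃ Z₁ Z₂ Z₃
  formConditions with disjointY | disjointZ
  ... | (dXY₁ ∷ dXY₂ ∷ dXY₃ ∷ []) ∷ (dY₁₂ ∷ dY₁₃ ∷ []) ∷ (dY₂₃ ∷ []) ∷ [] ∷ []
      | (dXZ₁ ∷ dXZ₂ ∷ dXZ₃ ∷ []) ∷ (dZ₁₂ ∷ dZ₁₃ ∷ []) ∷ (dZ₂₃ ∷ []) ∷ [] ∷ [] =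
    (dXY₁ , dXY₂ , dXY₃ , dY₁₂ , dY₁₃ , dY₂₃) , (dXZ₁ , dXZ₂ , dXZ₃ , dZ₁₂ , dZ₁₃ , dZ₂₃) , sums ,
    (distinct 0F 0F , distinct 0F 1F , distinct 0F 2F , distinct 1F 0F , distinct 1F 1F , distinct 1F 2F ,
     distinct 2F 0F , distinct 2F 1F , distinct 2F 2F) , nonempty

↭-swap₁₃ : ∀ {A : Set} {x y z : A} {xs} → x ∷ y ∷ z ∷ xs ↭ z ∷ y ∷ x ∷ xs
↭-swap₁₃ = ↭-trans (↭-swap _ _ ↭-refl) (↭-trans (prep _ (↭-swap _ _ ↭-refl)) (↭-swap _ _ ↭-refl))

-- In an extension at s, a block C of T becomes C [ s ]≔ b for some bit b.
module Lift (s : Fin n) where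

  point : Bool → Subset n
  point b = ⊥ [ s ]≔ b

  liftAll : Vec (Subset n) k → Vec Bool k → List (Subset n)
  liftAll Cs bs = toList (zipWith _[ s ]≔_ Cs bs)

  lifted : Subset n → Vec (Subset n) 3 → Vec (Subset n) 3 → Lifting → Pair n
  lifted X Y Z L = liftAll Y (a L) ++ liftAll (map (X ⊕_) Z) (b L) , liftAll Z (c L) ++ liftAll (map (X ⊕_) Y) (d L)

  -[]≔lookup : ∀ C → (C - s) [ s ]≔ lookup C s ≡ C
  -[]≔lookup C = begin
    (C - s) [ s ]≔ lookup C s           ≡⟨ cong (_[ s ]≔ lookup C s) (-≡[]≔false C s) ⟩
    C [ s ]≔ false [ s ]≔ lookup C s    ≡⟨ []≔-idempotent C s ⟩
    C [ s ]≔ lookup C s                 ≡⟨ []≔-lookup C s ⟩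
    C                                   ∎
    where open ≡-Reasoning

  []≔-remove : ∀ {C} b → s ∉ C → (C [ s ]≔ b) - s ≡ C
  []≔-remove {C} b s∉C = begin
    (C [ s ]≔ b) - s               ≡⟨ -≡[]≔false _ s ⟩
    C [ s ]≔ b [ s ]≔ false        ≡⟨ []≔-idempotent C s ⟩
    C [ s ]≔ false                 ≡⟨ cong (C [ s ]≔_) (sym (∉⇒lookup≡false s∉C)) ⟩
    C [ s ]≔ lookup C s            ≡⟨ []≔-lookup C s ⟩
    C                              ∎
    where open ≡-Reasoning

  []≔-injective : ∀ {A B} {p q} → s ∉ A → s ∉ B → A [ s ]≔ p ≡ B [ s ]≔ q → A ≡ B
  []≔-injective {p = p} {q} s∉A s∉B eq =
    trans (sym ([]≔-remove p s∉A)) (trans (cong (_- s) eq) ([]≔-remove q s∉B))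

  point-⊕-[]≔ : ∀ σ C p → point σ ⊕ (C [ s ]≔ p) ≡ C [ s ]≔ (σ xor p)
  point-⊕-[]≔ σ C p = trans (zipWith-[]≔ _xor_ ⊥ C s σ p)
                            (cong (_[ s ]≔ (σ xor p)) (zipWith-identityˡ xor-identityˡ C))

  []≔-disjoint : ∀ {A B} {p q} → Disjoint A B → p ∧ q ≡ false → Disjoint (A [ s ]≔ p) (B [ s ]≔ q)
  []≔-disjoint {A} {B} {p} {q} A∩B≡⊥ p∧q≡false = begin
    (A [ s ]≔ p) ∩ (B [ s ]≔ q)    ≡⟨ zipWith-[]≔ _∧_ A B s p q ⟩
    (A ∩ B) [ s ]≔ (p ∧ q)         ≡⟨ cong₂ _[ s ]≔_ A∩B≡⊥ p∧q≡false ⟩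
    ⊥ [ s ]≔ false                 ≡⟨ ⊥[]≔false s ⟩
    ⊥                              ∎
    where open ≡-Reasoning

  []≔-allPairs : ∀ {Cs : Vec (Subset n) k} {bs} → AllPairs Disjoint Cs → Exclusive bs →
                 AllPairs Disjoint (zipWith _[ s ]≔_ Cs bs)
  []≔-allPairs {Cs = []}     {[]}     []          []          = []
  []≔-allPairs {Cs = C ∷ Cs} {b ∷ bs} (dC ∷ dCs) (eb ∷ ebs) = head dC eb ∷ []≔-allPairs dCs ebs
    where
    head : ∀ {k} {Cs : Vec (Subset n) k} {bs} → All (Disjoint C) Cs → All (λ q → b ∧ q ≡ false) bs →
           All (Disjoint (C [ s ]≔ b)) (zipWith _[ s ]≔_ Cs bs)
    head {Cs = []}    {[]}    []       []       = []
    head {Cs = _ ∷ _} {_ ∷ _} (d ∷ ds) (e ∷ es) = []≔-disjoint d e ∷ head ds es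

  ⨁-[]≔ : ∀ (Cs : Vec (Subset n) 3) bs → ⨁ (zipWith _[ s ]≔_ Cs bs) ≡ ⨁ Cs [ s ]≔ parity bs
  ⨁-[]≔ (A ∷ B ∷ C ∷ []) (p ∷ q ∷ r ∷ []) = begin
    (A [ s ]≔ p) ⊕ (B [ s ]≔ q) ⊕ (C [ s ]≔ r)   ≡⟨ cong (_⊕ (C [ s ]≔ r)) (zipWith-[]≔ _xor_ A B s p q) ⟩
    ((A ⊕ B) [ s ]≔ (p xor q)) ⊕ (C [ s ]≔ r)    ≡⟨ zipWith-[]≔ _xor_ (A ⊕ B) C s (p xor q) r ⟩
    (A ⊕ B ⊕ C) [ s ]≔ ((p xor q) xor r)          ∎
    where open ≡-Reasoning

  cnt-liftAll : ∀ {e} → e ≢ s → ∀ (Cs : Vec (Subset n) k) bs →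
                cnt (⁅ s ⁆ ∪ ⁅ e ⁆) (liftAll Cs bs) ≡ dot (map (λ C → lookup C e) Cs) bs
  cnt-liftAll e≢s []       []       = refl
  cnt-liftAll {e = e} e≢s (C ∷ Cs) (b ∷ bs) = begin
    cnt (⁅ s ⁆ ∪ ⁅ e ⁆) (C [ s ]≔ b ∷ liftAll Cs bs)
      ≡⟨ cnt-pair s e _ _ ⟩
    toℕ (lookup (C [ s ]≔ b) s ∧ lookup (C [ s ]≔ b) e) + cnt (⁅ s ⁆ ∪ ⁅ e ⁆) (liftAll Cs bs)
      ≡⟨ cong₂ (λ p q → toℕ (p ∧ q) + _) (lookup∘update s C b) (lookup∘update′ e≢s C b) ⟩
    toℕ (b ∧ lookup C e) + cnt (⁅ s ⁆ ∪ ⁅ e ⁆) (liftAll Cs bs)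
      ≡⟨ cong₂ _+_ (cong toℕ (∧-comm b (lookup C e))) (cnt-liftAll e≢s Cs bs) ⟩
    dot (map (λ C → lookup C e) (C ∷ Cs)) (b ∷ bs)
      ∎
    where open ≡-Reasoning

  cnt-liftAll-s : ∀ (Cs : Vec (Subset n) k) bs → cnt (⁅ s ⁆ ∪ ⁅ s ⁆) (liftAll Cs bs) ≡ ones bs
  cnt-liftAll-s []       []       = refl
  cnt-liftAll-s (C ∷ Cs) (b ∷ bs) = begin
    cnt (⁅ s ⁆ ∪ ⁅ s ⁆) (C [ s ]≔ b ∷ liftAll Cs bs)
      ≡⟨ cnt-pair s s _ _ ⟩
    toℕ (lookup (C [ s ]≔ b) s ∧ lookup (C [ s ]≔ b) s) + cnt (⁅ s ⁆ ∪ ⁅ s ⁆) (liftAll Cs bs)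
      ≡⟨ cong₂ (λ p q → toℕ p + q) (trans (∧-idem _) (lookup∘update s C b)) (cnt-liftAll-s Cs bs) ⟩
    ones (b ∷ bs)
      ∎
    where open ≡-Reasoning

  unproject : ∀ (Cs : Vec (Subset n) k) {rest} zs → List.map (_- s) zs ≡ toList Cs ++ rest →
              ∃₂ λ bs zs′ → zs ≡ liftAll Cs bs ++ zs′ × List.map (_- s) zs′ ≡ rest
  unproject []       zs       eq = [] , zs , refl , eq
  unproject (C ∷ Cs) (z ∷ zs) eq with unproject Cs zs (∷-injectiveʳ eq)
  ... | bs , zs′ , refl , eq′ = lookup z s ∷ bs , zs′ , cong (_∷ _) z≡C[s]≔ , eq′
    where
    z≡C[s]≔ : z ≡ C [ s ]≔ lookup z s
    z≡C[s]≔ = trans (sym (-[]≔lookup z)) (cong (_[ s ]≔ lookup z s) (∷-injectiveˡ eq))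

  unproject₂ : ∀ (Cs Ds : Vec (Subset n) k) zs → List.map (_- s) zs ≡ toList Cs ++ toList Ds →
               ∃₂ λ bs bs′ → zs ≡ liftAll Cs bs ++ liftAll Ds bs′
  unproject₂ Cs Ds zs eq with unproject Cs zs eq
  ... | bs , zs′ , refl , eq′ with unproject Ds zs′ (trans eq′ (sym (++-identityʳ _)))
  ...   | bs′ , [] , refl , _ = bs , bs′ , cong (liftAll Cs bs ++_) (++-identityʳ _)

  liftAll-swap : ∀ (Cs : Vec (Subset n) 3) bs {i k} → i ≢ k → lookup Cs i ≡ lookup Cs k →
                 liftAll Cs (swap i k bs) ↭ liftAll Cs bs
  liftAll-swap (_ ∷ _ ∷ _ ∷ []) (_ ∷ _ ∷ _ ∷ []) {0F} {0F} 0≢0 _    = ⊥-elim (0≢0 refl)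
  liftAll-swap (_ ∷ _ ∷ _ ∷ []) (_ ∷ _ ∷ _ ∷ []) {0F} {1F} _   refl = ↭-swap _ _ ↭-refl
  liftAll-swap (_ ∷ _ ∷ _ ∷ []) (_ ∷ _ ∷ _ ∷ []) {0F} {2F} _   refl = ↭-swap₁₃
  liftAll-swap (_ ∷ _ ∷ _ ∷ []) (_ ∷ _ ∷ _ ∷ []) {1F} {0F} _   refl = ↭-swap _ _ ↭-refl
  liftAll-swap (_ ∷ _ ∷ _ ∷ []) (_ ∷ _ ∷ _ ∷ []) {1F} {1F} 1≢1 _    = ⊥-elim (1≢1 refl)
  liftAll-swap (_ ∷ _ ∷ _ ∷ []) (_ ∷ _ ∷ _ ∷ []) {1F} {2F} _   refl = prep _ (↭-swap _ _ ↭-refl)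
  liftAll-swap (_ ∷ _ ∷ _ ∷ []) (_ ∷ _ ∷ _ ∷ []) {2F} {0F} _   refl = ↭-swap₁₃
  liftAll-swap (_ ∷ _ ∷ _ ∷ []) (_ ∷ _ ∷ _ ∷ []) {2F} {1F} _   refl = prep _ (↭-swap _ _ ↭-refl)
  liftAll-swap (_ ∷ _ ∷ _ ∷ []) (_ ∷ _ ∷ _ ∷ []) {2F} {2F} 2≢2 _    = ⊥-elim (2≢2 refl)

  liftAll-xor : ∀ σ (Cs : Vec (Subset n) k) us →
                liftAll Cs (map (σ xor_) us) ≡ List.map (point σ ⊕_) (liftAll Cs us)
  liftAll-xor σ []       []       = refl
  liftAll-xor σ (C ∷ Cs) (u ∷ us) = cong₂ _∷_ (sym (point-⊕-[]≔ σ C u)) (liftAll-xor σ Cs us)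

  liftAll-⊕ : ∀ {X} x (Cs : Vec (Subset n) k) ws →
              liftAll (map (X ⊕_) Cs) (map (x xor_) ws) ≡ toList (map ((X [ s ]≔ x) ⊕_) (zipWith _[ s ]≔_ Cs ws))
  liftAll-⊕         x []       []       = refl
  liftAll-⊕ {X = X} x (C ∷ Cs) (w ∷ ws) = cong₂ _∷_ (sym (zipWith-[]≔ _xor_ X C s x w)) (liftAll-⊕ x Cs ws)

  lifted-shift : ∀ {X Y Z L σ x α β} → Decomposition L σ x α β →
                 lifted X Y Z L ≡ shift (point σ) (formᵛ (X [ s ]≔ x) (zipWith _[ s ]≔_ Y α) (zipWith _[ s ]≔_ Z β))
  lifted-shift {X} {Y} {Z} {lifting _ _ _ _} {σ} {x} {α} {β} (_ , _ , _ , refl , refl , refl , refl) =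
    cong₂ _,_ (leg Y Z α β) (leg Z Y β α)
    where
    pσ : List (Subset n) → List (Subset n)
    pσ = List.map (point σ ⊕_)
    leg : ∀ U W u w → liftAll U (map (σ xor_) u) ++ liftAll (map (X ⊕_) W) (map (σ xor_) (map (x xor_) w))
                    ≡ pσ (liftAll U u ++ toList (map ((X [ s ]≔ x) ⊕_) (zipWith _[ s ]≔_ W w)))
    leg U W u w = begin
      liftAll U (map (σ xor_) u) ++ liftAll (map (X ⊕_) W) (map (σ xor_) (map (x xor_) w))
        ≡⟨ cong₂ _++_ (liftAll-xor σ U u) (liftAll-xor σ (map (X ⊕_) W) (map (x xor_) w)) ⟩
      pσ (liftAll U u) ++ pσ (liftAll (map (X ⊕_) W) (map (x xor_) w))
        ≡⟨ cong (λ l → pσ (liftAll U u) ++ pσ l) (liftAll-⊕ x W w) ⟩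
      pσ (liftAll U u) ++ pσ (toList (map ((X [ s ]≔ x) ⊕_) (zipWith _[ s ]≔_ W w)))
        ≡⟨ sym (map-++ (point σ ⊕_) (liftAll U u) _) ⟩
      pσ (liftAll U u ++ toList (map ((X [ s ]≔ x) ⊕_) (zipWith _[ s ]≔_ W w)))
        ∎
      where open ≡-Reasoning

  lifted-conditions : ∀ {X} {Y Z : Vec (Subset n) 3} {x α β} → Conditions X Y Z →
                      s ∉ X → (∀ i → s ∉ lookup Y i) → (∀ j → s ∉ lookup Z j) →
                      Exclusive (x ∷ α) → Exclusive (x ∷ β) → parity α ≡ parity β →
                      Conditions (X [ s ]≔ x) (zipWith _[ s ]≔_ Y α) (zipWith _[ s ]≔_ Z β)
  lifted-conditions {X} {Y} {Z} {x} {α} {β} conditions s∉X s∉Y s∉Z exclusiveY exclusiveZ parities = record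
    { disjointY = []≔-allPairs disjointY exclusiveY
    ; disjointZ = []≔-allPairs disjointZ exclusiveZ
    ; sums      = trans (⨁-[]≔ Y α) (trans (cong₂ _[ s ]≔_ sums parities) (sym (⨁-[]≔ Z β)))
    ; distinct  = λ i j eq → distinct i j ([]≔-injective (s∉Y i) (s∉Z j)
                    (trans (sym (lookup-zipWith _[ s ]≔_ i Y α)) (trans eq (lookup-zipWith _[ s ]≔_ j Z β))))
    ; nonempty  = λ eq → nonempty (trans (sym ([]≔-remove x s∉X)) (trans (cong (_- s) eq) ⊥-s≡⊥))
    }
    where
    open Conditions conditions
    ⊥-s≡⊥ : ⊥ - s ≡ ⊥
    ⊥-s≡⊥ = trans (-≡[]≔false ⊥ s) (⊥[]≔false s)

module Extension (s : Fin n) (X : Subset n) (Y Z : Vec (Subset n) 3) (conditions : Conditions X Y Z)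
                 (s∉X : s ∉ X) (s∉Y : ∀ i → s ∉ lookup Y i) (s∉Z : ∀ j → s ∉ lookup Z j)
                 {T' : Pair n} (trade : IsTrade 2 T') where
  open Lift s
  open Conditions conditions

  membership : Fin n → Pattern
  membership e = lookup X e , map (λ C → lookup C e) Y , map (λ C → lookup C e) Z

  isEmpty : Subset n → Bool
  isEmpty C = does (C ≟ₛ ⊥)

  emptinessOf : Emptiness
  emptinessOf = emptiness (map isEmpty Y) (map isEmpty Z)

  lookups-⊕ : ∀ e (Cs : Vec (Subset n) k) →
              map (λ C → lookup C e) (map (X ⊕_) Cs) ≡ map (lookup X e xor_) (map (λ C → lookup C e) Cs)
  lookups-⊕ e Cs = trans (sym (map-∘ _ _ Cs)) (trans (map-cong (λ C → lookup-⊕ X C e) Cs) (map-∘ _ _ Cs))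

  cnt-leg : ∀ {e} → e ≢ s → ∀ (U : Vec (Subset n) 3) u (W : Vec (Subset n) 3) w →
            cnt (⁅ s ⁆ ∪ ⁅ e ⁆) (liftAll U u ++ liftAll (map (X ⊕_) W) w)
              ≡ dot (map (λ C → lookup C e) U) u + dot (map (lookup X e xor_) (map (λ C → lookup C e) W)) w
  cnt-leg {e} e≢s U u W w = trans (cnt-++ _ (liftAll U u) _)
    (cong₂ _+_ (cnt-liftAll e≢s U u) (trans (cnt-liftAll e≢s (map (X ⊕_) W) w) (cong (λ v → dot v w) (lookups-⊕ e W))))

  cnt-leg-s : ∀ (U : Vec (Subset n) 3) u (W : Vec (Subset n) 3) w →
              cnt (⁅ s ⁆ ∪ ⁅ s ⁆) (liftAll U u ++ liftAll (map (X ⊕_) W) w) ≡ ones u + ones w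
  cnt-leg-s U u W w = trans (cnt-++ _ (liftAll U u) _) (cong₂ _+_ (cnt-liftAll-s U u) (cnt-liftAll-s (map (X ⊕_) W) w))

  balanced-pair : ∀ {L} e → T' ≈ₚ lifted X Y Z L →
                  cnt (⁅ s ⁆ ∪ ⁅ e ⁆) (proj₁ (lifted X Y Z L)) ≡ cnt (⁅ s ⁆ ∪ ⁅ e ⁆) (proj₂ (lifted X Y Z L))
  balanced-pair {L} e (P↭ , M↭) = begin
    cnt S (proj₁ (lifted X Y Z L))   ≡⟨ sym (cnt-↭ S P↭) ⟩
    cnt S (proj₁ T')                 ≡⟨ proj₂ trade ∣ S ∣ (∣⁅x⁆∪⁅y⁆∣≤2 s e) S refl ⟩
    cnt S (proj₂ T')                 ≡⟨ cnt-↭ S M↭ ⟩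
    cnt S (proj₂ (lifted X Y Z L))   ∎
    where
    S : Subset n
    S = ⁅ s ⁆ ∪ ⁅ e ⁆
    open ≡-Reasoning

  balanced-membership : ∀ {L e} → T' ≈ₚ lifted X Y Z L → e ≢ s → Balanced L (membership e)
  balanced-membership {L} {e} T'≈ e≢s = trans (sym (cnt-leg e≢s Y (a L) Z (b L)))
    (trans (balanced-pair e T'≈) (cnt-leg e≢s Z (c L) Y (d L)))

  balancedₛ : ∀ {L} → T' ≈ₚ lifted X Y Z L → Balancedₛ L
  balancedₛ {L} T'≈ = trans (sym (cnt-leg-s Y (a L) Z (b L))) (trans (balanced-pair s T'≈) (cnt-leg-s Z (c L) Y (d L)))

  valid-membership : ∀ e → Valid (membership e)
  valid-membership e =
    map⁺ (allPairs-map (λ d → lookup-disjoint d e) disjointY) ,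
    map⁺ (allPairs-map (λ d → lookup-disjoint d e) disjointZ) ,
    trans (sym (lookup-⨁ Y e)) (trans (cong (λ C → lookup C e) sums) (lookup-⨁ Z e))

  shape : ∀ e → Shape (membership e)
  shape e = classify (membership e) (valid-membership e)

  lookupY : ∀ {e x y z} → membership e ≡ (x , y , z) → ∀ i → lookup (lookup Y i) e ≡ lookup y i
  lookupY {e} eq i = trans (sym (lookup-map i (λ C → lookup C e) Y)) (cong (λ p → lookup (proj₁ (proj₂ p)) i) eq)

  lookupZ : ∀ {e x y z} → membership e ≡ (x , y , z) → ∀ j → lookup (lookup Z j) e ≡ lookup z j
  lookupZ {e} eq j = trans (sym (lookup-map j (λ C → lookup C e) Z)) (cong (λ p → lookup (proj₂ (proj₂ p)) j) eq)

  inYZ-unless-outside : ∀ e → (∀ {x} → membership e ≢ (x , zeros , zeros)) → ∃₂ λ k l → membership e ≡ inYZ k l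
  inYZ-unless-outside e ¬outside with shape e
  ... | inj₁ eq        = ⊥-elim (¬outside eq)
  ... | inj₂ (inj₁ eq) = ⊥-elim (¬outside eq)
  ... | inj₂ (inj₂ kl) = kl

  ∈Y⇒inYZ : ∀ {e} i → lookup (lookup Y i) e ≡ true → ∃₂ λ k l → membership e ≡ inYZ k l
  ∈Y⇒inYZ {e} i e∈ = inYZ-unless-outside e λ eq →
    true≢false (trans (sym e∈) (trans (lookupY eq i) (lookup-replicate i false)))

  ∈Z⇒inYZ : ∀ {e} j → lookup (lookup Z j) e ≡ true → ∃₂ λ k l → membership e ≡ inYZ k l
  ∈Z⇒inYZ {e} j e∈ = inYZ-unless-outside e λ eq →
    true≢false (trans (sym e∈) (trans (lookupZ eq j) (lookup-replicate j false)))

  ∈X⇒inX : ∀ {e} → lookup X e ≡ true → membership e ≡ inX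
  ∈X⇒inX {e} e∈ with shape e
  ... | inj₁ eq                  = ⊥-elim (true≢false (trans (sym e∈) (cong proj₁ eq)))
  ... | inj₂ (inj₁ eq)           = eq
  ... | inj₂ (inj₂ (_ , _ , eq)) = ⊥-elim (true≢false (trans (sym e∈) (cong proj₁ eq)))

  edge : ∀ {L e k l} → T' ≈ₚ lifted X Y Z L → membership e ≡ inYZ k l → Edge L emptinessOf k l
  edge {L} {e} {k} {l} T'≈ eq =
    trans (lookup-map k isEmpty Y) (nonempty-flag (lookup Y k) e∈Y) ,
    trans (lookup-map l isEmpty Z) (nonempty-flag (lookup Z l) e∈Z) ,
    balanced⇒balancedAt L k l (subst (Balanced L) eq (balanced-membership T'≈ (lookup≡true⇒≢ (s∉Y k) e∈Y)))
    where
    e∈Y : lookup (lookup Y k) e ≡ true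
    e∈Y = trans (lookupY eq k) (lookup∘update k zeros true)
    e∈Z : lookup (lookup Z l) e ≡ true
    e∈Z = trans (lookupZ eq l) (lookup∘update l zeros true)
    nonempty-flag : ∀ C → lookup C e ≡ true → isEmpty C ≡ false
    nonempty-flag C e∈C = dec-false (C ≟ₛ ⊥) λ C≡⊥ →
      true≢false (trans (sym e∈C) (trans (cong (λ D → lookup D e) C≡⊥) (lookup-⊥ e)))

  balanced-inX : ∀ {L} → T' ≈ₚ lifted X Y Z L → Balanced L inX
  balanced-inX {L} T'≈ with nonempty⇒element nonempty
  ... | e , e∈X = subst (Balanced L) (∈X⇒inX e∈X) (balanced-membership T'≈ (lookup≡true⇒≢ s∉X e∈X))

  witnessed : ∀ {L} → T' ≈ₚ lifted X Y Z L → Witnessed L emptinessOf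
  witnessed {L} T'≈ = separated , coveredY , coveredZ
    where
    separated : ∀ i j → ∃₂ λ k l → lookup (unit k) i ≢ lookup (unit l) j × Edge L emptinessOf k l
    separated i j with ≢⇒lookup≢ (distinct i j)
    ... | e , differ with [ ∈Y⇒inYZ i , ∈Z⇒inYZ j ]′ (≢⇒true⊎true differ)
    ...   | k , l , eq =
      k , l , (λ same → differ (trans (lookupY eq i) (trans same (sym (lookupZ eq j))))) , edge T'≈ eq
    coveredY : ∀ i → lookup (map isEmpty Y) i ≡ true ⊎ ∃₂ λ k l → lookup (unit k) i ≡ true × Edge L emptinessOf k l
    coveredY i with lookup Y i ≟ₛ ⊥
    ... | yes Yᵢ≡⊥ = inj₁ (trans (lookup-map i isEmpty Y) (dec-true (lookup Y i ≟ₛ ⊥) Yᵢ≡⊥))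
    ... | no Yᵢ≢⊥ with nonempty⇒element Yᵢ≢⊥
    ...   | e , e∈ with ∈Y⇒inYZ i e∈
    ...     | k , l , eq = inj₂ (k , l , trans (sym (lookupY eq i)) e∈ , edge T'≈ eq)
    coveredZ : ∀ j → lookup (map isEmpty Z) j ≡ true ⊎ ∃₂ λ k l → lookup (unit l) j ≡ true × Edge L emptinessOf k l
    coveredZ j with lookup Z j ≟ₛ ⊥
    ... | yes Zⱼ≡⊥ = inj₁ (trans (lookup-map j isEmpty Z) (dec-true (lookup Z j ≟ₛ ⊥) Zⱼ≡⊥))
    ... | no Zⱼ≢⊥ with nonempty⇒element Zⱼ≢⊥
    ...   | e , e∈ with ∈Z⇒inYZ j e∈
    ...     | k , l , eq = inj₂ (k , l , trans (sym (lookupZ eq j)) e∈ , edge T'≈ eq)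

  isEmpty⇒≡⊥ : ∀ (Cs : Vec (Subset n) 3) i → lookup (map isEmpty Cs) i ≡ true → lookup Cs i ≡ ⊥
  isEmpty⇒≡⊥ Cs i flag = decided (lookup Cs i ≟ₛ ⊥) (trans (sym (lookup-map i isEmpty Cs)) flag)

  lifting-of-extension : projection s T' ≈ₚ formᵛ X Y Z → volume T' ≡ volume (formᵛ X Y Z) →
                         ∃ λ L → T' ≈ₚ lifted X Y Z L
  lifting-of-extension projected volume≡ with projection-trivial s projected volume≡
  ... | P↭ , M↭ with ↭-map-inv (_- s) P↭ | ↭-map-inv (_- s) M↭
  ...   | P″ , P-eq , P'↭P″ | M″ , M-eq , M'↭M″
          with unproject₂ Y (map (X ⊕_) Z) P″ (sym P-eq) | unproject₂ Z (map (X ⊕_) Y) M″ (sym M-eq)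
  ...     | a , b , refl | c , d , refl = lifting a b c d , P'↭P″ , M'↭M″

  complete-lifting : ∀ {L} → T' ≈ₚ lifted X Y Z L → ∃ λ L′ → Complete L′ × T' ≈ₚ lifted X Y Z L′
  complete-lifting {L} T'≈@(P↭ , M↭) =
    relabel (balanced⇒relabelling L emptinessOf (balancedₛ T'≈) (balanced-inX T'≈) (witnessed T'≈))
    where
    relabel : Relabelling L emptinessOf → ∃ λ L′ → Complete L′ × T' ≈ₚ lifted X Y Z L′
    relabel (inj₁ complete) = L , complete , T'≈
    relabel (inj₂ (inj₁ (i , k , i≢k , emptyᵢ , emptyₖ , complete))) =
      record L { a = swap i k (a L) } , complete , ↭-trans P↭ (++⁺ʳ _ (↭-sym (liftAll-swap Y (a L) i≢k
                       (trans (isEmpty⇒≡⊥ Y i emptyᵢ) (sym (isEmpty⇒≡⊥ Y k emptyₖ)))))) , M↭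
    relabel (inj₂ (inj₂ (j , l , j≢l , emptyⱼ , emptyₗ , complete))) =
      record L { c = swap j l (c L) } , complete , P↭ , ↭-trans M↭ (++⁺ʳ _ (↭-sym (liftAll-swap Z (c L) j≢l
                       (trans (isEmpty⇒≡⊥ Z j emptyⱼ) (sym (isEmpty⇒≡⊥ Z l emptyₗ))))))

  shift-of-form : ∀ {L} → Complete L → T' ≈ₚ lifted X Y Z L → ShiftOfForm T'
  shift-of-form {L} complete T'≈ =
    let σ , x , α , β , decomposition@(exclusiveY , exclusiveZ , parities , _) =
          complete⇒decomposition L (balancedₛ T'≈) (balanced-inX T'≈) complete
    in shiftOfForm (point σ) (lifted-conditions conditions s∉X s∉Y s∉Z exclusiveY exclusiveZ parities)
                   (subst (T' ≈ₚ_) (lifted-shift {X} {Y} {Z} decomposition) T'≈)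

avoids-form : ∀ {s : Fin n} {X Y₁ Y₂ Y₃ Z₁ Z₂ Z₃} → Avoids s (form X Y₁ Y₂ Y₃ Z₁ Z₂ Z₃) →
              s ∉ X × (∀ i → s ∉ lookup (Y₁ ∷ Y₂ ∷ Y₃ ∷ []) i) × (∀ j → s ∉ lookup (Z₁ ∷ Z₂ ∷ Z₃ ∷ []) j)
avoids-form {X = X} {Y₁} {Y₂} {Y₃} {Z₁} {Z₂} {Z₃} avoids =
  ∉-⊕ (proj₁ (avoids (X ⊕ Z₁)) (there (there (there (here refl))))) (proj₂ (avoids Z₁) (here refl)) ,
  (λ { 0F → proj₁ (avoids Y₁) (here refl)
     ; 1F → proj₁ (avoids Y₂) (there (here refl))
     ; 2F → proj₁ (avoids Y₃) (there (there (here refl))) }) ,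
  (λ { 0F → proj₂ (avoids Z₁) (here refl)
     ; 1F → proj₂ (avoids Z₂) (there (here refl))
     ; 2F → proj₂ (avoids Z₃) (there (there (here refl))) })

proposition6p5 : ∀ (n : ℕ) (X Y₁ Y₂ Y₃ Z₁ Z₂ Z₃ : Subset n) →
    FormConditions X Y₁ Y₂ Y₃ Z₁ Z₂ Z₃ →
    ∀ (T' : Pair n) → IsExtension 2 (form X Y₁ Y₂ Y₃ Z₁ Z₂ Z₃) T' →
    Σ (Subset n) λ Y → Σ (Subset n) λ X' →
    Σ (Subset n) λ Y₁' → Σ (Subset n) λ Y₂' → Σ (Subset n) λ Y₃' →
    Σ (Subset n) λ Z₁' → Σ (Subset n) λ Z₂' → Σ (Subset n) λ Z₃' →
      FormConditions X' Y₁' Y₂' Y₃' Z₁' Z₂' Z₃' ×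
      (T' ≈ₚ shift Y (form X' Y₁' Y₂' Y₃' Z₁' Z₂' Z₃'))
proposition6p5 n X Y₁ Y₂ Y₃ Z₁ Z₂ Z₃ formConditions T' (trade , (s , avoids , projected) , volume≡) =
  let s∉X , s∉Y , s∉Z = avoids-form avoids
      open Extension s X (Y₁ ∷ Y₂ ∷ Y₃ ∷ []) (Z₁ ∷ Z₂ ∷ Z₃ ∷ []) (fromFormConditions formConditions)
                     s∉X s∉Y s∉Z trade
      L , T'≈L = lifting-of-extension projected volume≡
      L′ , complete , T'≈L′ = complete-lifting {L} T'≈L
  in shift-of-form {L′} complete T'≈L′
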